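{- Let $N,k\ge0$. Then for every $i\ge0$, $$I_{M_{e_N}}^i\cdot\mathbb{F}_2^{L_k}=I_{\Omega_\infty}^{\,i+\left[\frac{i}{2^{N+1}-1}\right]}\cdot\mathbb{F}_2^{L_k},$$ where $[z]$ denotes the integer nearest to $z$.
   Context: $T_\infty$: Cayley graph of the free monoid on $\{x,y\}$ (word $w$ joined to $xw,yw$), $L_k$ = words of length $k$, $\Omega_\infty$ its profinite automorphism group. For a word $w$, $\sigma_w$ is the involution fixing words not ending in $w$ and sending $v'w\mapsto\overline{v'}w$ ($x,y$ swapped in $v'$); each $\sigma$ is uniquely $\lim_N\sigma_N\cdots\sigma_0$ with $\sigma_i=\prod_{w\in L_i}\sigma_w^{\varepsilon_w(\sigma)}$, and $\phi_i(\sigma)=\sum_{w\in L_i}\varepsilon_w(\sigma)$. $e_N$ is the $N$-th standard basis vector of $\mathbb{F}_2^{(\mathbb{Z}_{\ge0})}$, so $M_{e_N}=\ker\phi_N$. $\mathbb{F}_2^{L_k}$ is the permutation module with basis $L_k$, on which subgroups of $\Omega_\infty$ act via the action on $L_k$; $I_H$ denotes the augmentation ideal of $\mathbb{F}_2[H]$. (Note $i/(2^{N+1}-1)$ is never a half-integer, so $[\cdot]$ is well defined.) -}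

module Defs where

open import Data.Bool using (Bool; true; false; not; _xor_; if_then_else_)
open import Data.Nat using (ℕ; zero; suc; _+_; _*_; _∸_; _^_)
open import Data.Nat.DivMod using (_/_)
open import Data.List using (List; []; _∷_; drop; foldr; map; concatMap)
open import Data.Vec using (Vec; []; _∷_; toList)
open import Data.Unit using (⊤)
open import Relation.Binary.PropositionalEquality using (_≡_)

-- Letters: false = x, true = y.  A word w is a list of letters written
-- left to right as in the paper; w is joined to x w and y w, so the
-- ancestor of a word at level i is its suffix of length i.
Word : Set
Word = List Bool

allWords : ℕ → List Word
allWords zero    = [] ∷ []
allWords (suc n) = concatMap (λ w → (false ∷ w) ∷ (true ∷ w) ∷ []) (allWords n)

-- An element σ of Ω_∞ is given (uniquely) by its labelling
-- ε(σ) : Word → F_2, with σ = lim σ_N ⋯ σ_0,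
-- σ_i = ∏_{w ∈ L_i} σ_w^{ε_w(σ)}.
Omega : Set
Omega = Word → Bool

flipFirst : {k : ℕ} → ℕ → Vec Bool k → Vec Bool k
flipFirst zero    u       = u
flipFirst (suc m) []      = []
flipFirst (suc m) (b ∷ u) = not b ∷ flipFirst m u

-- action of σ_i on a word u of length k: u = v' w with |w| = i;
-- if ε_w = 1 then v' w ↦ \bar{v'} w, else fixed.
-- (for i ≥ k this is the identity, as it should be.)
sigmaLevel : {k : ℕ} → Omega → ℕ → Vec Bool k → Vec Bool k
sigmaLevel {k} ε i u =
  if ε (drop (k ∸ i) (toList u)) then flipFirst (k ∸ i) u else u

-- σ acting on L_k : σ_{k-1} ⋯ σ_0 (σ_0 applied first); σ_i for i ≥ k
-- act trivially on L_k.
actUpTo : {k : ℕ} → Omega → ℕ → Vec Bool k → Vec Bool k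
actUpTo ε zero    u = u
actUpTo ε (suc n) u = sigmaLevel ε n (actUpTo ε n u)

act : {k : ℕ} → Omega → Vec Bool k → Vec Bool k
act {k} ε u = actUpTo ε k u

-- σ^{-1} acting on L_k : σ_0 ⋯ σ_{k-1} (each σ_i is an involution).
invUpTo : {k : ℕ} → Omega → ℕ → Vec Bool k → Vec Bool k
invUpTo ε zero    u = u
invUpTo ε (suc n) u = invUpTo ε n (sigmaLevel ε n u)

actInv : {k : ℕ} → Omega → Vec Bool k → Vec Bool k
actInv {k} ε u = invUpTo ε k u

phi : ℕ → Omega → Bool
phi N ε = foldr _xor_ false (map ε (allWords N))

M-e : ℕ → Omega → Set
M-e N ε = phi N ε ≡ false

Whole : Omega → Set
Whole _ = ⊤

Module : ℕ → Set
Module k = Vec Bool k → Bool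

-- permutation action: (σ·v)(u) = v(σ^{-1} u), i.e. σ·e_u = e_{σ u}
_·_ : {k : ℕ} → Omega → Module k → Module k
(σ · v) u = v (actInv σ u)

_⊕_ : {k : ℕ} → Module k → Module k → Module k
(a ⊕ b) u = a u xor b u

-- IPow H i v  :  v ∈ I_H^i · F_2^{L_k}.
-- I_H^0 · V = V and I_H^{i+1} · V = span{ (h - 1) u : h ∈ H, u ∈ I_H^i · V }
-- (elements of F_2^{L_k} are taken up to pointwise equality).
data IPow {k : ℕ} (H : Omega → Set) : ℕ → Module k → Set where
  everything : ∀ v → IPow H zero v
  zeroVec    : ∀ {i} → IPow H (suc i) (λ _ → false)
  gen        : ∀ {i} σ u → H σ → IPow H i u → IPow H (suc i) ((σ · u) ⊕ u)
  plus       : ∀ {i a b} → IPow H (suc i) a → IPow H (suc i) b →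
               IPow H (suc i) (a ⊕ b)
  ext        : ∀ {i a b} → (∀ w → a w ≡ b w) → IPow H i a → IPow H i b

-- nearest integer to i / d for d odd (never a half-integer):
-- [i/d] = ⌊(2i + d) / (2d)⌋.  (d = 0 never occurs.)
roundDiv : ℕ → ℕ → ℕ
roundDiv i zero    = zero
roundDiv i (suc d) = (2 * i + suc d) / (2 * suc d)

-- Write f ∈ F_2^{L_(k+1)} as f (x u) = f₀ u + (x + u₁) f₁ u, u₁ the first letter of u.
-- Commutators act triangularly on (f₁, f₀), which makes the Ω_∞-filtration explicit:
-- f ∈ I^j iff f₁ ∈ I^j and f₀ ∈ I^(j − 2^k) on L_k. The claim is that I_M^i F_2^{L_k} is
-- layer ρ(i) = i + [i / (2^(N+1) − 1)] of it, M = M_{e_N}. For k ≤ N, M contains Ω_k and ρ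
-- differs from the identity only beyond the last layer. For k = N + 1, M skips exactly layer
-- 2^N, by a parity argument with φ_N. From k to k + 1 both the cost of lift₀ in I_M and its
-- depth in the filtration scale so that ρ(i + c) = ρ(i) + 2^k carries the claim over.

module Submission where

open import Defs
open import Data.Nat using (ℕ; suc; _+_; _∸_; _^_)
open import Data.Bool using (Bool)
open import Data.Vec using (Vec)
open import Function.Bundles using (_⇔_; mk⇔)

open import Data.Bool using (true; false; not; _xor_; _∧_)
import Data.Bool.Properties as Bool
open import Data.Bool.Properties
  using (xor-same; xor-identityʳ; xor-assoc; xor-comm; ∧-zeroʳ; ∧-distribˡ-xor; ∧-distribʳ-xor)
open import Data.Empty using (⊥-elim)
open import Data.List using (List; []; _∷_; length; drop; foldr; map; concatMap)
open import Data.Nat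
  using (zero; _*_; _≤_; _<_; z≤n; s≤s; _≤?_; _<?_; _≤′_; ≤′-refl; ≤′-step)
open import Data.Nat.DivMod
  using (_/_; /-congˡ; /-monoˡ-≤; m<n⇒m/n≡0; m≥n⇒m/n>0; m/n≡1+[m∸n]/n)
open import Data.Nat.Properties
open import Data.Nat.Tactic.RingSolver using (solve-∀)
open import Data.Product using (_×_; _,_; proj₁; proj₂)
open import Data.Unit using (tt)
open import Data.Vec using ([]; _∷_; toList; last; replicate)
open import Data.Vec.Properties using (length-toList)
import Function.Properties.Equivalence as ⇔
open import Relation.Binary.Definitions using (tri<; tri≈; tri>)
open import Relation.Binary.PropositionalEquality
open import Relation.Nullary using (yes; no)
open import Relation.Nullary.Decidable using (Dec; True; toWitness; map′; _×-dec_)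

-- Identities between Boolean expressions in n variables, checked by evaluating
-- all 2ⁿ assignments; the two sides are inferred from the goal by higher-order
-- pattern unification, so  tautology n  proves any goal  ∀ x₁ … xₙ → l ≡ r.
Op : ℕ → Set
Op zero    = Bool
Op (suc n) = Bool → Op n

_≗ⁿ_ : ∀ {n} → Op n → Op n → Set
_≗ⁿ_ {zero}  a b = a ≡ b
_≗ⁿ_ {suc n} f g = ∀ x → f x ≗ⁿ g x

_≗ⁿ?_ : ∀ {n} (f g : Op n) → Dec (f ≗ⁿ g)
_≗ⁿ?_ {zero}  a b = a Bool.≟ b
_≗ⁿ?_ {suc n} f g =
  map′ (λ { (p , q) false → p ; (p , q) true → q }) (λ h → h false , h true)
       ((f false ≗ⁿ? g false) ×-dec (f true ≗ⁿ? g true))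

tautology : ∀ n {f g : Op n} {_ : True (f ≗ⁿ? g)} → f ≗ⁿ g
tautology n {_} {_} {p} = toWitness p

xor-cancelˡ : ∀ a b → a xor (a xor b) ≡ b
xor-cancelˡ = tautology 2

xor-cancelʳ : ∀ a b → a xor b xor b ≡ a
xor-cancelʳ = tautology 2

xor-interchange : ∀ a b c d → (a xor b) xor (c xor d) ≡ (a xor c) xor (b xor d)
xor-interchange = tautology 4

bool-interpolation : ∀ (F : Bool → Bool) x h → F x ≡ F h xor ((x xor h) ∧ (F h xor F (not h)))
bool-interpolation F false false = sym (xor-identityʳ (F false))
bool-interpolation F true  true  = sym (xor-identityʳ (F true))
bool-interpolation F true  false = sym (xor-cancelˡ (F false) (F true))
bool-interpolation F false true  = sym (xor-cancelˡ (F true) (F false))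

-- The action on the first letter

first : ∀ {k} → Vec Bool k → Bool
first []      = false
first (x ∷ _) = x

0ᴹ 1ᴹ : ∀ {k} → Module k
0ᴹ _ = false
1ᴹ _ = true

-- In  f (x ∷ u) = split₀ f u xor ((x xor first u) ∧ split₁ f u)  the new letter is measured
-- relative to the next one: σ changes  x xor first u  only by σ(u) (actInv-∷), which makes
-- split₀ and split₁ almost equivariant.
split₀ split₁ : ∀ {k} → Module (suc k) → Module k
split₀ f u = f (first u ∷ u)
split₁ f u = f (first u ∷ u) xor f (not (first u) ∷ u)

lift₀ lift₁ : ∀ {k} → Module k → Module (suc k)
lift₀ g (x ∷ u) = g u
lift₁ g (x ∷ u) = (x xor first u) ∧ g u

split-recon : ∀ {k} (f : Module (suc k)) x u →
  f (x ∷ u) ≡ split₀ f u xor ((x xor first u) ∧ split₁ f u)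
split-recon f x u = bool-interpolation (λ y → f (y ∷ u)) x (first u)

split₁≗0⇒≡split₀ : ∀ {k} (f : Module (suc k)) → split₁ f ≗ 0ᴹ →
  ∀ x u → f (x ∷ u) ≡ split₀ f u
split₁≗0⇒≡split₀ f split₁≗0 x u = begin
  f (x ∷ u)                                      ≡⟨ split-recon f x u ⟩
  split₀ f u xor ((x xor first u) ∧ split₁ f u)  ≡⟨ cong (λ b → split₀ f u xor (c ∧ b)) (split₁≗0 u) ⟩
  split₀ f u xor ((x xor first u) ∧ false)       ≡⟨ cong (split₀ f u xor_) (∧-zeroʳ c) ⟩
  split₀ f u xor false                           ≡⟨ xor-identityʳ (split₀ f u) ⟩
  split₀ f u                                     ∎
  where
  open ≡-Reasoning
  c : Bool
  c = x xor first u

lift-split : ∀ {k} (f : Module (suc k)) → lift₀ (split₀ f) ⊕ lift₁ (split₁ f) ≗ f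
lift-split f (x ∷ u) = sym (split-recon f x u)

sigmaLevel-∷ : ∀ {k} ε n x (v : Vec Bool k) → n < k →
  sigmaLevel ε n (x ∷ v) ≡ (x xor first v xor first (sigmaLevel ε n v)) ∷ sigmaLevel ε n v
sigmaLevel-∷ {suc k} ε n x (y ∷ v) (s≤s n≤k)
  rewrite +-∸-assoc 1 (m≤n⇒m≤1+n n≤k) | +-∸-assoc 1 n≤k
  with ε (drop (k ∸ n) (toList v))
... | true  = cong (_∷ _) (flipped x y)
  where
  flipped : ∀ x y → not x ≡ x xor y xor not y
  flipped = tautology 2
... | false = cong (_∷ _) (sym (xor-cancelʳ x y))

invUpTo-∷ : ∀ {k} ε n x (v : Vec Bool k) → n ≤ k →
  invUpTo ε n (x ∷ v) ≡ (x xor first v xor first (invUpTo ε n v)) ∷ invUpTo ε n v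
invUpTo-∷ ε zero x v _ = cong (_∷ v) (sym (xor-cancelʳ x (first v)))
invUpTo-∷ ε (suc n) x v n<k
  rewrite sigmaLevel-∷ ε n x v n<k
        | invUpTo-∷ ε n (x xor first v xor first (sigmaLevel ε n v)) (sigmaLevel ε n v) (<⇒≤ n<k)
  = cong (_∷ _) (telescope x (first v) (first (sigmaLevel ε n v))
                              (first (invUpTo ε n (sigmaLevel ε n v))))
  where
  telescope : ∀ x a b c → (x xor a xor b) xor b xor c ≡ x xor a xor c
  telescope = tautology 4

actInv-∷ : ∀ {k} σ x (u : Vec Bool k) →
  actInv σ (x ∷ u) ≡ (x xor first u xor σ (toList u) xor first (actInv σ u)) ∷ actInv σ u
actInv-∷ {k} σ x u rewrite m+n∸n≡m 1 k with σ (toList u)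
... | true  rewrite invUpTo-∷ σ k (not x) u ≤-refl =
  cong (_∷ _) (flipped x (first u) (first (invUpTo σ k u)))
  where
  flipped : ∀ x a b → not x xor a xor b ≡ x xor a xor true xor b
  flipped = tautology 3
... | false rewrite invUpTo-∷ σ k x u ≤-refl = refl

relative-letter : ∀ x a e b → (x xor a xor e xor b) xor b ≡ x xor a xor e
relative-letter = tautology 4

·-∷ : ∀ {k} σ (f : Module (suc k)) x u →
  (σ · f) (x ∷ u) ≡ (σ · split₀ f) u xor ((x xor first u xor σ (toList u)) ∧ (σ · split₁ f) u)
·-∷ σ f x u rewrite actInv-∷ σ x u =
  trans (split-recon f _ (actInv σ u))
        (cong (λ c → split₀ f (actInv σ u) xor (c ∧ split₁ f (actInv σ u)))
              (relative-letter x (first u) (σ (toList u)) (first (actInv σ u))))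

·-lift₀ : ∀ {k} σ (g : Module k) → σ · lift₀ g ≗ lift₀ (σ · g)
·-lift₀ σ g (x ∷ u) rewrite actInv-∷ σ x u = refl

·-lift₁ : ∀ {k} σ (g : Module k) → (∀ u → σ (toList u) ≡ false) →
  σ · lift₁ g ≗ lift₁ (σ · g)
·-lift₁ σ g σ≡0 (x ∷ u) rewrite actInv-∷ σ x u | σ≡0 u =
  cong (_∧ _) (trans (relative-letter x (first u) false (first (actInv σ u)))
                     (cong (x xor_) (xor-identityʳ (first u))))

split₁-commutator : ∀ {k} σ (f : Module (suc k)) →
  split₁ ((σ · f) ⊕ f) ≗ (σ · split₁ f) ⊕ split₁ f
split₁-commutator σ f u =
  trans (cong₂ _xor_ (cong (_xor f (first u ∷ u)) (·-∷ σ f (first u) u))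
                     (cong (_xor f (not (first u) ∷ u)) (·-∷ σ f (not (first u)) u)))
        (difference ((σ · split₀ f) u) ((σ · split₁ f) u) (σ (toList u)) (first u)
                    (f (first u ∷ u)) (f (not (first u) ∷ u)))
  where
  difference : ∀ a b e h c d →
    ((a xor (h xor h xor e) ∧ b) xor c) xor ((a xor (not h xor h xor e) ∧ b) xor d) ≡ b xor c xor d
  difference = tautology 6

split₀-commutator : ∀ {k} σ (f : Module (suc k)) →
  split₀ ((σ · f) ⊕ f) ≗
  ((σ · split₀ f) ⊕ split₀ f) ⊕ (λ u → σ (toList u) ∧ (σ · split₁ f) u)
split₀-commutator σ f u =
  trans (cong (_xor f (first u ∷ u)) (·-∷ σ f (first u) u))
        (base ((σ · split₀ f) u) ((σ · split₁ f) u) (σ (toList u)) (first u) (f (first u ∷ u)))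
  where
  base : ∀ a b e h c → (a xor (h xor h xor e) ∧ b) xor c ≡ (a xor c) xor e ∧ b
  base = tautology 5

split₀-commutator′ : ∀ {k} σ (f : Module (suc k)) → split₁ f ≗ 0ᴹ →
  split₀ ((σ · f) ⊕ f) ≗ (σ · split₀ f) ⊕ split₀ f
split₀-commutator′ σ f split₁≗0 u
  rewrite split₀-commutator σ f u | split₁≗0 (actInv σ u) | ∧-zeroʳ (σ (toList u)) =
  xor-identityʳ _

-- The explicit filtration

2^suc : ∀ k → 2 ^ suc k ≡ 2 ^ k + 2 ^ k
2^suc k = cong (2 ^ k +_) (+-identityʳ (2 ^ k))

1≤2^ : ∀ k → 1 ≤ 2 ^ k
1≤2^ k = m^n>0 2 k

m+n∸o∸m≡n∸o : ∀ m n o → m + n ∸ o ∸ m ≡ n ∸ o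
m+n∸o∸m≡n∸o m n o =
  trans (∸-+-assoc (m + n) o m) (trans (cong (m + n ∸_) (+-comm o m)) ([m+n]∸[m+o]≡n∸o m n o))

2^suc∸o∸2^≡2^∸o : ∀ k o → 2 ^ suc k ∸ o ∸ 2 ^ k ≡ 2 ^ k ∸ o
2^suc∸o∸2^≡2^∸o k o =
  trans (cong (λ n → n ∸ o ∸ 2 ^ k) (2^suc k)) (m+n∸o∸m≡n∸o (2 ^ k) (2 ^ k) o)

suc[2^∸1]≡2^ : ∀ k → suc (2 ^ k ∸ 1) ≡ 2 ^ k
suc[2^∸1]≡2^ k = trans (sym (+-∸-assoc 1 (1≤2^ k))) (m+n∸m≡n 1 (2 ^ k))

2^≡suc[2^∸1] : ∀ N → 2 ^ N ≡ suc (2 ^ N ∸ 1)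
2^≡suc[2^∸1] N = sym (suc[2^∸1]≡2^ N)

2^suc∸1≡suc[2*[2^∸1]] : ∀ N → 2 ^ suc N ∸ 1 ≡ suc (2 * (2 ^ N ∸ 1))
2^suc∸1≡suc[2*[2^∸1]] N =
  trans (cong (λ p → 2 * p ∸ 1) (2^≡suc[2^∸1] N)) (cong (_∸ 1) (*-suc 2 (2 ^ N ∸ 1)))

1≤2^suc∸1 : ∀ N → 1 ≤ 2 ^ suc N ∸ 1
1≤2^suc∸1 N = subst (1 ≤_) (sym (2^suc∸1≡suc[2*[2^∸1]] N)) (s≤s z≤n)

2^≤2^suc∸1 : ∀ k → 2 ^ k ≤ 2 ^ suc k ∸ 1
2^≤2^suc∸1 k = begin
  2 ^ k                 ≤⟨ m≤m+n (2 ^ k) (2 ^ k ∸ 1) ⟩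
  2 ^ k + (2 ^ k ∸ 1)   ≡⟨ +-∸-assoc (2 ^ k) (1≤2^ k) ⟨
  2 ^ k + 2 ^ k ∸ 1     ≡⟨ cong (_∸ 1) (2^suc k) ⟨
  2 ^ suc k ∸ 1         ∎
  where open ≤-Reasoning

2^<2^suc : ∀ N → 2 ^ N < 2 ^ suc N
2^<2^suc N = subst (2 ^ N <_) (sym (2^suc N)) (m<m+n (2 ^ N) (1≤2^ N))

m<n⇒m≤n∸1 : ∀ {m n} → m < n → m ≤ n ∸ 1
m<n⇒m≤n∸1 {n = suc n} (s≤s m≤n) = m≤n

m∸[n∸1]≡1+m∸n : ∀ m {n} → 1 ≤ n → m ∸ (n ∸ 1) ≡ suc m ∸ n
m∸[n∸1]≡1+m∸n m (s≤s z≤n) = refl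

-- Fil k j f  is the explicit form of  f ∈ I_{Ω_∞}^j · F_2^{L_k}  (see IPow⇔Fil):
-- I^j F_2^{L_(k+1)} = lift₁ (I^j F_2^{L_k}) ⊕ lift₀ (I^(j ∸ 2^k) F_2^{L_k}).
data Fil : (k : ℕ) → ℕ → Module k → Set where
  fil-top    : ∀ {f} → Fil zero zero f
  fil-null   : ∀ {j f} → f [] ≡ false → Fil zero j f
  fil-layers : ∀ {k j f} → Fil k j (split₁ f) → Fil k (j ∸ 2 ^ k) (split₀ f) → Fil (suc k) j f

Fil-resp : ∀ k {j} {f g : Module k} → f ≗ g → Fil k j f → Fil k j g
Fil-resp zero    f≗g fil-top         = fil-top
Fil-resp zero    f≗g (fil-null f≡0)  = fil-null (trans (sym (f≗g [])) f≡0)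
Fil-resp (suc k) f≗g (fil-layers F₁ F₀) =
  fil-layers (Fil-resp k (λ u → cong₂ _xor_ (f≗g _) (f≗g _)) F₁) (Fil-resp k (λ u → f≗g _) F₀)

Fil-idx : ∀ k {i j} {f : Module k} → i ≡ j → Fil k i f → Fil k j f
Fil-idx k refl F = F

Fil-0ᴹ : ∀ k j → Fil k j 0ᴹ
Fil-0ᴹ zero    j = fil-null refl
Fil-0ᴹ (suc k) j = fil-layers (Fil-0ᴹ k j) (Fil-0ᴹ k _)

Fil-top : ∀ k (f : Module k) → Fil k 0 f
Fil-top zero    f = fil-top
Fil-top (suc k) f = fil-layers (Fil-top k _) (Fil-idx k (sym (0∸n≡0 (2 ^ k))) (Fil-top k _))

Fil-⊕ : ∀ k {j} {f g : Module k} → Fil k j f → Fil k j g → Fil k j (f ⊕ g)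
Fil-⊕ zero    fil-top        _              = fil-top
Fil-⊕ zero    (fil-null _)   fil-top        = fil-top
Fil-⊕ zero    (fil-null f≡0) (fil-null g≡0) = fil-null (cong₂ _xor_ f≡0 g≡0)
Fil-⊕ (suc k) {f = f} {g} (fil-layers F₁ F₀) (fil-layers G₁ G₀) =
  fil-layers (Fil-resp k (λ u → xor-interchange (f (first u ∷ u)) (f (not (first u) ∷ u))
                                                (g (first u ∷ u)) (g (not (first u) ∷ u)))
                         (Fil-⊕ k F₁ G₁))
             (Fil-⊕ k F₀ G₀)

Fil-antitone : ∀ k {i j} {f : Module k} → i ≤ j → Fil k j f → Fil k i f
Fil-antitone zero    z≤n fil-top            = fil-top
Fil-antitone zero    i≤j (fil-null f≡0)     = fil-null f≡0
Fil-antitone (suc k) i≤j (fil-layers F₁ F₀) =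
  fil-layers (Fil-antitone k i≤j F₁) (Fil-antitone k (∸-monoˡ-≤ (2 ^ k) i≤j) F₀)

Fil-vanishes : ∀ k {j} {f : Module k} → 2 ^ k ≤ j → Fil k j f → f ≗ 0ᴹ
Fil-vanishes zero    () fil-top
Fil-vanishes zero    _  (fil-null f≡0) [] = f≡0
Fil-vanishes (suc k) {j} {f} 2^k+2^k≤j (fil-layers F₁ F₀) (x ∷ u) =
  trans (split₁≗0⇒≡split₀ f split₁≗0 x u) (Fil-vanishes k 2^k≤j∸2^k F₀ u)
  where
  2^k≤j∸2^k : 2 ^ k ≤ j ∸ 2 ^ k
  2^k≤j∸2^k = subst (_≤ j ∸ 2 ^ k) (m+n∸n≡m (2 ^ k) (2 ^ k))
                    (∸-monoˡ-≤ (2 ^ k) (subst (_≤ j) (2^suc k) 2^k+2^k≤j))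
  split₁≗0 : split₁ f ≗ 0ᴹ
  split₁≗0 = Fil-vanishes k (≤-trans 2^k≤j∸2^k (m∸n≤m j (2 ^ k))) F₁

Fil-beyond : ∀ k {i j} {f : Module k} → 2 ^ k ≤ j → Fil k j f → Fil k i f
Fil-beyond k 2^k≤j F = Fil-resp k (λ w → sym (Fil-vanishes k 2^k≤j F w)) (Fil-0ᴹ k _)

Fil-commutator : ∀ k σ {j} {f : Module k} → Fil k j f → Fil k (suc j) ((σ · f) ⊕ f)
Fil-commutator zero    σ {f = f} _ = fil-null (xor-same (f []))
Fil-commutator (suc k) σ {j} {f} (fil-layers F₁ F₀) =
  fil-layers (Fil-resp k (λ u → sym (split₁-commutator σ f u)) (Fil-commutator k σ F₁)) C₀
  where
  C₀ : Fil k (suc j ∸ 2 ^ k) (split₀ ((σ · f) ⊕ f))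
  C₀ with 2 ^ k ≤? j
  ... | no  2^k≰j = Fil-idx k (sym (m≤n⇒m∸n≡0 (≰⇒> 2^k≰j))) (Fil-top k _)
  ... | yes 2^k≤j =
    Fil-idx k (sym (+-∸-assoc 1 2^k≤j))
      (Fil-resp k (λ u → sym (split₀-commutator′ σ f (Fil-vanishes k 2^k≤j F₁) u))
                  (Fil-commutator k σ F₀))

Fil-1ᴹ : ∀ k → Fil k (2 ^ k ∸ 1) 1ᴹ
Fil-1ᴹ zero    = fil-top
Fil-1ᴹ (suc k) = fil-layers (Fil-0ᴹ k _) (Fil-idx k (sym (2^suc∸o∸2^≡2^∸o k 1)) (Fil-1ᴹ k))

module _ {k : ℕ} {H : Omega → Set} where

  IPow-idx : ∀ {i j} {v : Module k} → i ≡ j → IPow H i v → IPow H j v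
  IPow-idx refl p = p

  IPow-pred : ∀ i {v : Module k} → IPow H (suc i) v → IPow H i v
  IPow-pred zero    _             = everything _
  IPow-pred (suc i) zeroVec       = zeroVec
  IPow-pred (suc i) (gen σ u h p) = gen σ u h (IPow-pred i p)
  IPow-pred (suc i) (plus p q)    = plus (IPow-pred (suc i) p) (IPow-pred (suc i) q)
  IPow-pred (suc i) (ext e p)     = ext e (IPow-pred (suc i) p)

  IPow-antitone : ∀ {i j} {v : Module k} → i ≤ j → IPow H j v → IPow H i v
  IPow-antitone i≤j = go (≤⇒≤′ i≤j)
    where
    go : ∀ {i j} {v : Module k} → i ≤′ j → IPow H j v → IPow H i v
    go ≤′-refl        p = p
    go (≤′-step i≤′j) p = go i≤′j (IPow-pred _ p)

IPow-⊕ : ∀ {k} {H : Omega → Set} i {a b : Module k} → IPow H i a → IPow H i b → IPow H i (a ⊕ b)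
IPow-⊕ zero    _ _ = everything _
IPow-⊕ (suc i) p q = plus p q

IPow-split : ∀ {k j} {H : Omega → Set} {f : Module (suc k)} →
  IPow H j (lift₀ (split₀ f)) → IPow H j (lift₁ (split₁ f)) → IPow H j f
IPow-split {j = j} {f = f} p₀ p₁ = ext (lift-split f) (IPow-⊕ j p₀ p₁)

IPow-⊆ : ∀ {k} {H H′ : Omega → Set} → (∀ σ → H σ → H′ σ) →
  ∀ {i} {v : Module k} → IPow H i v → IPow H′ i v
IPow-⊆ H⊆H′ (everything v)  = everything v
IPow-⊆ H⊆H′ zeroVec         = zeroVec
IPow-⊆ H⊆H′ (gen σ u h p)   = gen σ u (H⊆H′ σ h) (IPow-⊆ H⊆H′ p)
IPow-⊆ H⊆H′ (plus p q)      = plus (IPow-⊆ H⊆H′ p) (IPow-⊆ H⊆H′ q)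
IPow-⊆ H⊆H′ (ext e p)       = ext e (IPow-⊆ H⊆H′ p)

IPow⇒Fil : ∀ {k} {H : Omega → Set} (F : ℕ → ℕ) → F 0 ≡ 0 →
  (∀ σ → H σ → ∀ {i g} → Fil k (F i) g → Fil k (F (suc i)) ((σ · g) ⊕ g)) →
  ∀ {i} {v : Module k} → IPow H i v → Fil k (F i) v
IPow⇒Fil {k} F F0≡0 step (everything v) = Fil-idx k (sym F0≡0) (Fil-top k v)
IPow⇒Fil {k} F F0≡0 step zeroVec        = Fil-0ᴹ k _
IPow⇒Fil     F F0≡0 step (gen σ u h p)  = step σ h (IPow⇒Fil F F0≡0 step p)
IPow⇒Fil {k} F F0≡0 step (plus p q)     =
  Fil-⊕ k (IPow⇒Fil F F0≡0 step p) (IPow⇒Fil F F0≡0 step q)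
IPow⇒Fil {k} F F0≡0 step (ext e p)      = Fil-resp k e (IPow⇒Fil F F0≡0 step p)

module Equivariant {k : ℕ} {H H′ : Omega → Set} (H⊆H′ : ∀ σ → H σ → H′ σ)
  (L : Module k → Module (suc k))
  (L-resp : ∀ {a b} → a ≗ b → L a ≗ L b) (L-0ᴹ : L 0ᴹ ≗ 0ᴹ)
  (L-⊕ : ∀ a b → L (a ⊕ b) ≗ L a ⊕ L b)
  (L-· : ∀ σ → H σ → ∀ g → σ · L g ≗ L (σ · g)) where

  IPow-map-shift : ∀ c → (∀ g → IPow H′ c (L g)) →
    ∀ {j g} → IPow H j g → IPow H′ (j + c) (L g)
  IPow-map-shift c base (everything v) = base v
  IPow-map-shift c base zeroVec        = ext (λ w → sym (L-0ᴹ w)) zeroVec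
  IPow-map-shift c base (gen σ u h p)  =
    ext (λ w → trans (cong (_xor L u w) (L-· σ h u w)) (sym (L-⊕ (σ · u) u w)))
        (gen σ (L u) (H⊆H′ σ h) (IPow-map-shift c base p))
  IPow-map-shift c base (plus {a = a} {b} p q) =
    ext (λ w → sym (L-⊕ a b w)) (plus (IPow-map-shift c base p) (IPow-map-shift c base q))
  IPow-map-shift c base (ext e p) = ext (L-resp e) (IPow-map-shift c base p)

  IPow-map : ∀ {j g} → IPow H j g → IPow H′ j (L g)
  IPow-map {j} p = IPow-idx (+-identityʳ j) (IPow-map-shift 0 (λ g → everything (L g)) p)

module _ {k : ℕ} {H H′ : Omega → Set} (H⊆H′ : ∀ σ → H σ → H′ σ) where

  IPow-lift₀-shift : ∀ c → (∀ g → IPow H′ c (lift₀ g)) →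
    ∀ {j g} → IPow H j g → IPow H′ (j + c) (lift₀ {k} g)
  IPow-lift₀-shift = Equivariant.IPow-map-shift H⊆H′ lift₀
    (λ { a≗b (x ∷ u) → a≗b u }) (λ { (x ∷ u) → refl }) (λ { a b (x ∷ u) → refl })
    (λ σ _ → ·-lift₀ σ)

  IPow-lift₀ : ∀ c → (∀ g → IPow H′ c (lift₀ g)) →
    ∀ j {g} → (c ≤ j → IPow H (j ∸ c) g) → IPow H′ j (lift₀ {k} g)
  IPow-lift₀ c base j {g} deep with c ≤? j
  ... | yes c≤j = IPow-idx (m∸n+n≡m c≤j) (IPow-lift₀-shift c base (deep c≤j))
  ... | no  c≰j = IPow-antitone (<⇒≤ (≰⇒> c≰j)) (base g)

  IPow-lift₁ : (∀ σ → H σ → ∀ u → σ (toList u) ≡ false) →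
    ∀ {j g} → IPow H j g → IPow H′ j (lift₁ {k} g)
  IPow-lift₁ level-k-trivial = Equivariant.IPow-map H⊆H′ lift₁
    (λ { a≗b (x ∷ u) → cong ((x xor first u) ∧_) (a≗b u) }) (λ { (x ∷ u) → ∧-zeroʳ _ })
    (λ { a b (x ∷ u) → ∧-distribˡ-xor (x xor first u) (a u) (b u) })
    (λ σ h g → ·-lift₁ σ g (level-k-trivial σ h))

-- The elements of Ω_∞ acting through the finite quotient Ω_k = Aut(T_k).
SupportedBelow : ℕ → Omega → Set
SupportedBelow k σ = ∀ w → k ≤ length w → σ w ≡ false

SupportedBelow-suc : ∀ {k} σ → SupportedBelow k σ → SupportedBelow (suc k) σ
SupportedBelow-suc {k} σ σ<k w k<∣w∣ = σ<k w (≤-trans (n≤1+n k) k<∣w∣)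

SupportedBelow-L : ∀ {k} σ → SupportedBelow k σ → ∀ (u : Vec Bool k) → σ (toList u) ≡ false
SupportedBelow-L σ σ<k u = σ<k (toList u) (≤-reflexive (sym (length-toList u)))

padTo : (k : ℕ) → List Bool → Vec Bool k
padTo zero    _        = []
padTo (suc k) []       = false ∷ padTo k []
padTo (suc k) (x ∷ xs) = x ∷ padTo k xs

padTo-toList : ∀ {k} (u : Vec Bool k) → padTo k (toList u) ≡ u
padTo-toList []      = refl
padTo-toList (x ∷ u) = cong (x ∷_) (padTo-toList u)

σ-level : (k : ℕ) → Module k → Omega
σ-level k g w with length w ≟ k
... | yes _ = g (padTo k w)
... | no  _ = false

σ-level-L : ∀ k g (u : Vec Bool k) → σ-level k g (toList u) ≡ g u
σ-level-L k g u with length (toList u) ≟ k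
... | yes _     = cong g (padTo-toList u)
... | no  ∣u∣≢k = ⊥-elim (∣u∣≢k (length-toList u))

σ-level-off : ∀ k g w → length w ≢ k → σ-level k g w ≡ false
σ-level-off k g w ∣w∣≢k with length w ≟ k
... | yes ∣w∣≡k = ⊥-elim (∣w∣≢k ∣w∣≡k)
... | no  _     = refl

σ-level-supported : ∀ k g → SupportedBelow (suc k) (σ-level k g)
σ-level-supported k g w k<∣w∣ =
  σ-level-off k g w (λ ∣w∣≡k → <-irrefl (sym ∣w∣≡k) k<∣w∣)

σ-level-commutator : ∀ {k} (g : Module k) → (σ-level k g · lift₁ 1ᴹ) ⊕ lift₁ 1ᴹ ≗ lift₀ g
σ-level-commutator {k} g (x ∷ u) rewrite actInv-∷ (σ-level k g) x u | σ-level-L k g u =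
  swap-all x (first u) (g u) (first (actInv (σ-level k g) u))
  where
  swap-all : ∀ x a e b → ((x xor a xor e xor b) xor b) ∧ true xor (x xor a) ∧ true ≡ e
  swap-all = tautology 4

Fil⇒IPow : ∀ k {j} {f : Module k} → Fil k j f → IPow (SupportedBelow k) j f
Fil⇒IPow zero    {zero}  _            = everything _
Fil⇒IPow zero    {suc j} (fil-null f≡0) = ext (λ { [] → sym f≡0 }) zeroVec
Fil⇒IPow (suc k) {j}     (fil-layers F₁ F₀) =
  IPow-split (IPow-lift₀ SupportedBelow-suc (2 ^ k) lift₀-depth j (λ _ → Fil⇒IPow k F₀))
             (IPow-lift₁ SupportedBelow-suc SupportedBelow-L (Fil⇒IPow k F₁))
  where
  lift₀-depth : ∀ g → IPow (SupportedBelow (suc k)) (2 ^ k) (lift₀ g)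
  lift₀-depth g = IPow-idx (suc[2^∸1]≡2^ k)
    (ext (σ-level-commutator g)
         (gen (σ-level k g) (lift₁ 1ᴹ) (σ-level-supported k g)
              (IPow-lift₁ SupportedBelow-suc SupportedBelow-L (Fil⇒IPow k (Fil-1ᴹ k)))))

IPow⇔Fil : ∀ k {H : Omega → Set} → (∀ σ → SupportedBelow k σ → H σ) →
  ∀ i (v : Module k) → IPow H i v ⇔ Fil k i v
IPow⇔Fil k Ω_k⊆H i v =
  mk⇔ (IPow⇒Fil (λ j → j) refl (λ σ _ → Fil-commutator k σ))
      (λ F → IPow-⊆ Ω_k⊆H (Fil⇒IPow k F))

-- Nearest-integer rounding

roundDiv-mono : ∀ d {i j} → i ≤ j → roundDiv i d ≤ roundDiv j d
roundDiv-mono zero    _   = z≤n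
roundDiv-mono (suc d) i≤j = /-monoˡ-≤ (2 * suc d) (+-monoˡ-≤ (suc d) (*-monoʳ-≤ 2 i≤j))

roundDiv-+ : ∀ i d → roundDiv (i + suc d) (suc d) ≡ suc (roundDiv i (suc d))
roundDiv-+ i d = begin
  (2 * (i + suc d) + suc d) / (2 * suc d)             ≡⟨ /-congˡ (regroup i d) ⟩
  (2 * suc d + (2 * i + suc d)) / (2 * suc d)         ≡⟨ m/n≡1+[m∸n]/n (m≤m+n (2 * suc d) _) ⟩
  suc ((2 * suc d + (2 * i + suc d) ∸ 2 * suc d) / (2 * suc d))
    ≡⟨ cong (λ m → suc (m / (2 * suc d))) (m+n∸m≡n (2 * suc d) _) ⟩
  suc ((2 * i + suc d) / (2 * suc d))                 ∎
  where
  open ≡-Reasoning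
  regroup : ∀ i d → 2 * (i + suc d) + suc d ≡ 2 * suc d + (2 * i + suc d)
  regroup = solve-∀

roundDiv-+* : ∀ i m {d} → 1 ≤ d → roundDiv (i + m * d) d ≡ roundDiv i d + m
roundDiv-+* i zero    {suc d} _ =
  trans (cong (λ j → roundDiv j (suc d)) (+-identityʳ i)) (sym (+-identityʳ _))
roundDiv-+* i (suc m) {suc d} 1≤d = begin
  roundDiv (i + (suc d + m * suc d)) (suc d)
    ≡⟨ cong (λ j → roundDiv j (suc d)) (regroup i d (m * suc d)) ⟩
  roundDiv (i + m * suc d + suc d) (suc d)   ≡⟨ roundDiv-+ (i + m * suc d) d ⟩
  suc (roundDiv (i + m * suc d) (suc d))     ≡⟨ cong suc (roundDiv-+* i m 1≤d) ⟩
  suc (roundDiv i (suc d) + m)               ≡⟨ sym (+-suc _ m) ⟩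
  roundDiv i (suc d) + suc m                 ∎
  where
  open ≡-Reasoning
  regroup : ∀ i d e → i + (suc d + e) ≡ i + e + suc d
  regroup = solve-∀

roundDiv-small : ∀ q {i} → i ≤ q → roundDiv i (suc (2 * q)) ≡ 0
roundDiv-small q {i} i≤q = m<n⇒m/n≡0 (begin-strict
  2 * i + suc (2 * q)       ≤⟨ +-monoˡ-≤ (suc (2 * q)) (*-monoʳ-≤ 2 i≤q) ⟩
  2 * q + suc (2 * q)       <⟨ n<1+n _ ⟩
  suc (2 * q + suc (2 * q)) ≡⟨ regroup q ⟩
  2 * suc (2 * q)           ∎)
  where
  open ≤-Reasoning
  regroup : ∀ q → suc (2 * q + suc (2 * q)) ≡ 2 * suc (2 * q)
  regroup = solve-∀

roundDiv-pos : ∀ q {i} → q < i → 1 ≤ roundDiv i (suc (2 * q))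
roundDiv-pos q {i} q<i = m≥n⇒m/n>0 (begin
  2 * suc (2 * q)           ≤⟨ n≤1+n _ ⟩
  suc (2 * suc (2 * q))     ≡⟨ regroup q ⟩
  2 * suc q + suc (2 * q)   ≤⟨ +-monoˡ-≤ (suc (2 * q)) (*-monoʳ-≤ 2 q<i) ⟩
  2 * i + suc (2 * q)       ∎)
  where
  open ≤-Reasoning
  regroup : ∀ q → suc (2 * suc (2 * q)) ≡ 2 * suc q + suc (2 * q)
  regroup = solve-∀

ρ : ℕ → ℕ → ℕ
ρ N i = i + roundDiv i (2 ^ suc N ∸ 1)

ρ-expand : ∀ N i → ρ N i ≡ i + roundDiv i (suc (2 * (2 ^ N ∸ 1)))
ρ-expand N i = cong (λ d → i + roundDiv i d) (2^suc∸1≡suc[2*[2^∸1]] N)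

ρ-id : ∀ N {i} → i < 2 ^ N → ρ N i ≡ i
ρ-id N {i} i<2^N = begin
  ρ N i                                          ≡⟨ ρ-expand N i ⟩
  i + roundDiv i (suc (2 * (2 ^ N ∸ 1)))
    ≡⟨ cong (i +_) (roundDiv-small (2 ^ N ∸ 1) (m<n⇒m≤n∸1 i<2^N)) ⟩
  i + 0                                          ≡⟨ +-identityʳ i ⟩
  i                                              ∎
  where open ≡-Reasoning

ρ-0 : ∀ N → ρ N 0 ≡ 0
ρ-0 N = ρ-id N (1≤2^ N)

ρ-≥ : ∀ N {i} → 2 ^ N ≤ i → suc i ≤ ρ N i
ρ-≥ N {i} 2^N≤i = begin
  suc i                                          ≡⟨ +-comm 1 i ⟩
  i + 1
    ≤⟨ +-monoʳ-≤ i (roundDiv-pos (2 ^ N ∸ 1) (subst (_≤ i) (2^≡suc[2^∸1] N) 2^N≤i)) ⟩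
  i + roundDiv i (suc (2 * (2 ^ N ∸ 1)))         ≡⟨ ρ-expand N i ⟨
  ρ N i                                          ∎
  where open ≤-Reasoning

ρ-≤ : ∀ N {i} → i < 2 ^ suc N → ρ N i ≤ suc i
ρ-≤ N {i} i<2^sucN = begin
  i + roundDiv i D               ≤⟨ +-monoʳ-≤ i (roundDiv-mono D (m<n⇒m≤n∸1 i<2^sucN)) ⟩
  i + roundDiv D D               ≡⟨ cong (λ j → i + roundDiv j D) (*-identityˡ D) ⟨
  i + roundDiv (0 + 1 * D) D     ≡⟨ cong (i +_) (roundDiv-+* 0 1 (1≤2^suc∸1 N)) ⟩
  i + (roundDiv 0 D + 1)         ≡⟨ cong (λ r → i + (r + 1)) (ρ-0 N) ⟩
  i + 1                          ≡⟨ +-comm i 1 ⟩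
  suc i                          ∎
  where
  open ≤-Reasoning
  D : ℕ
  D = 2 ^ suc N ∸ 1

ρ-mono : ∀ N {i j} → i ≤ j → ρ N i ≤ ρ N j
ρ-mono N i≤j = +-mono-≤ i≤j (roundDiv-mono (2 ^ suc N ∸ 1) i≤j)

ρ-< : ∀ N i → ρ N i < ρ N (suc i)
ρ-< N i = s≤s (+-monoʳ-≤ i (roundDiv-mono (2 ^ suc N ∸ 1) (n≤1+n i)))

ρ-periodic : ∀ N m i → ρ N (i + m * (2 ^ suc N ∸ 1)) ≡ ρ N i + m * 2 ^ suc N
ρ-periodic N m i = begin
  i + m * D + roundDiv (i + m * D) D    ≡⟨ cong (i + m * D +_) (roundDiv-+* i m (1≤2^suc∸1 N)) ⟩
  i + m * D + (roundDiv i D + m)        ≡⟨ regroup i (roundDiv i D) m D ⟩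
  ρ N i + m * (D + 1)                   ≡⟨ cong (λ p → ρ N i + m * p) (m∸n+n≡m (1≤2^ (suc N))) ⟩
  ρ N i + m * 2 ^ suc N                 ∎
  where
  open ≡-Reasoning
  D : ℕ
  D = 2 ^ suc N ∸ 1
  regroup : ∀ i r m D → i + m * D + (r + m) ≡ i + r + m * (D + 1)
  regroup = solve-∀

parity : (k : ℕ) → Module k → Bool
parity zero    g = g []
parity (suc k) g = parity k (λ u → g (false ∷ u) xor g (true ∷ u))

parity-resp : ∀ k {f g : Module k} → f ≗ g → parity k f ≡ parity k g
parity-resp zero    f≗g = f≗g []
parity-resp (suc k) f≗g = parity-resp k (λ u → cong₂ _xor_ (f≗g _) (f≗g _))

parity-⊕ : ∀ k (f g : Module k) → parity k (f ⊕ g) ≡ parity k f xor parity k g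
parity-⊕ zero    f g = refl
parity-⊕ (suc k) f g =
  trans (parity-resp k (λ u → xor-interchange (f (false ∷ u)) (g (false ∷ u))
                                               (f (true ∷ u)) (g (true ∷ u))))
        (parity-⊕ k _ _)

parity-0ᴹ : ∀ k {f : Module k} → f ≗ 0ᴹ → parity k f ≡ false
parity-0ᴹ zero    f≗0 = f≗0 []
parity-0ᴹ (suc k) f≗0 = parity-0ᴹ k (λ u → cong₂ _xor_ (f≗0 _) (f≗0 _))

foldr-xor-pairs : ∀ (h : List Bool → Bool) ws →
  foldr _xor_ false (map h (concatMap (λ w → (false ∷ w) ∷ (true ∷ w) ∷ []) ws)) ≡
  foldr _xor_ false (map (λ w → h (false ∷ w) xor h (true ∷ w)) ws)
foldr-xor-pairs h []       = refl
foldr-xor-pairs h (w ∷ ws) =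
  trans (cong (λ s → h (false ∷ w) xor h (true ∷ w) xor s) (foldr-xor-pairs h ws))
        (sym (xor-assoc (h (false ∷ w)) (h (true ∷ w)) _))

foldr-xor-allWords : ∀ n (h : List Bool → Bool) →
  foldr _xor_ false (map h (allWords n)) ≡ parity n (λ u → h (toList u))
foldr-xor-allWords zero    h = xor-identityʳ (h [])
foldr-xor-allWords (suc n) h =
  trans (foldr-xor-pairs h (allWords n)) (foldr-xor-allWords n (λ w → h (false ∷ w) xor h (true ∷ w)))

phi≡parity : ∀ N σ → phi N σ ≡ parity N (λ u → σ (toList u))
phi≡parity N σ = foldr-xor-allWords N σ

phi-SupportedBelow : ∀ {N k} σ → k ≤ N → SupportedBelow k σ → phi N σ ≡ false
phi-SupportedBelow {N} σ k≤N σ<k =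
  trans (phi≡parity N σ)
        (parity-0ᴹ N (λ u → σ<k (toList u) (≤-trans k≤N (≤-reflexive (sym (length-toList u))))))

split₁≗pair-sum : ∀ {k} (g : Module (suc k)) →
  split₁ g ≗ λ u → g (false ∷ u) xor g (true ∷ u)
split₁≗pair-sum g u with first u
... | false = refl
... | true  = xor-comm (g (true ∷ u)) (g (false ∷ u))

Fil-parity : ∀ k {g : Module k} → parity k g ≡ false → Fil k 1 g
Fil-parity zero    Σg≡0 = fil-null Σg≡0
Fil-parity (suc k) {g} Σg≡0 =
  fil-layers (Fil-parity k (trans (parity-resp k (split₁≗pair-sum g)) Σg≡0))
             (Fil-idx k (sym (m≤n⇒m∸n≡0 (1≤2^ k))) (Fil-top k _))

Fil-last-constant : ∀ k {g : Module k} → Fil k (2 ^ k ∸ 1) g → ∀ u v → g u ≡ g v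
Fil-last-constant zero    F [] [] = refl
Fil-last-constant (suc k) {g} (fil-layers F₁ F₀) (x ∷ u) (y ∷ v) = begin
  g (x ∷ u)   ≡⟨ split₁≗0⇒≡split₀ g split₁≗0 x u ⟩
  split₀ g u  ≡⟨ Fil-last-constant k (Fil-idx k (2^suc∸o∸2^≡2^∸o k 1) F₀) u v ⟩
  split₀ g v  ≡⟨ split₁≗0⇒≡split₀ g split₁≗0 y v ⟨
  g (y ∷ v)   ∎
  where
  open ≡-Reasoning
  split₁≗0 : split₁ g ≗ 0ᴹ
  split₁≗0 = Fil-vanishes k (2^≤2^suc∸1 k) F₁

-- The subgroup M_{e_N}

Fil-lift₀ : ∀ k {j} {g : Module k} → Fil k (j ∸ 2 ^ k) g → Fil (suc k) j (lift₀ g)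
Fil-lift₀ k {g = g} F = fil-layers (Fil-resp k (λ u → sym (xor-same (g u))) (Fil-0ᴹ k _)) F

last-actInv : ∀ {n} σ (u : Vec Bool (suc n)) → last (actInv σ u) ≡ last u xor σ []
last-actInv {zero}  σ (x ∷ []) with σ []
... | true  = sym (xor-comm x true)
... | false = sym (xor-identityʳ x)
last-actInv {suc n} σ (x ∷ y ∷ w) rewrite actInv-∷ σ x (y ∷ w) = last-actInv σ (y ∷ w)

Fil-last : ∀ n → Fil (suc n) (2 ^ suc n ∸ 2) last
Fil-last zero    = Fil-top 1 last
Fil-last (suc n) =
  Fil-resp (suc (suc n)) {f = lift₀ last} (λ { (x ∷ y ∷ v) → refl })
    (Fil-lift₀ (suc n) (Fil-idx (suc n) (sym (2^suc∸o∸2^≡2^∸o (suc n) 2)) (Fil-last n)))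

δxᵏ δyᵏ : ∀ {n} → Vec Bool n → Bool
δxᵏ []      = true
δxᵏ (x ∷ u) = not x ∧ δxᵏ u
δyᵏ []      = true
δyᵏ (x ∷ u) = x ∧ δyᵏ u

parity-δxᵏ : ∀ n → parity n δxᵏ ≡ true
parity-δxᵏ zero    = refl
parity-δxᵏ (suc n) = trans (parity-resp n (λ u → xor-identityʳ (δxᵏ u))) (parity-δxᵏ n)

parity-δyᵏ : ∀ n → parity n δyᵏ ≡ true
parity-δyᵏ zero    = refl
parity-δyᵏ (suc n) = parity-δyᵏ n

δxᵏ-last : ∀ {n} (u : Vec Bool (suc n)) → δxᵏ u ∧ not (last u) ≡ δxᵏ u
δxᵏ-last (true ∷ [])        = refl
δxᵏ-last (false ∷ [])       = refl
δxᵏ-last (true ∷ y ∷ w)     = refl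
δxᵏ-last (false ∷ y ∷ w)    = δxᵏ-last (y ∷ w)

δyᵏ-last : ∀ {n} (u : Vec Bool (suc n)) → δyᵏ u ∧ not (last u) ≡ false
δyᵏ-last (true ∷ [])        = refl
δyᵏ-last (false ∷ [])       = refl
δyᵏ-last (true ∷ y ∷ w)     = δyᵏ-last (y ∷ w)
δyᵏ-last (false ∷ y ∷ w)    = refl

root : Omega
root []      = true
root (_ ∷ _) = false

M-below : ℕ → ℕ → Omega → Set
M-below N k σ = M-e N σ × SupportedBelow k σ

M-below-⊇Ω : ∀ N σ → SupportedBelow N σ → M-below N (suc N) σ
M-below-⊇Ω N σ σ<N = phi-SupportedBelow σ ≤-refl σ<N , SupportedBelow-suc σ σ<N

IPow-lift₁-M : ∀ N {j} {g : Module N} →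
  IPow (SupportedBelow N) j g → IPow (M-below N (suc N)) j (lift₁ g)
IPow-lift₁-M N = IPow-lift₁ (M-below-⊇Ω N) SupportedBelow-L

lift₁-1ᴹ-depth : ∀ N → IPow (M-below N (suc N)) (2 ^ N ∸ 1) (lift₁ 1ᴹ)
lift₁-1ᴹ-depth N = IPow-lift₁-M N (Fil⇒IPow N (Fil-1ᴹ N))

lift₀-even-depth : ∀ N {h : Module N} → parity N h ≡ false →
  IPow (M-below N (suc N)) (2 ^ N) (lift₀ h)
lift₀-even-depth N {h} Σh≡0 = IPow-idx (suc[2^∸1]≡2^ N)
  (ext (σ-level-commutator h)
       (gen (σ-level N h) (lift₁ 1ᴹ)
            (trans (phi≡parity N _) (trans (parity-resp N (σ-level-L N h)) Σh≡0) , σ-level-supported N h)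
            (lift₁-1ᴹ-depth N)))

-- For N ≥ 1, σ_∅ σ_{x…x} σ_{y…y} lies in M_{e_N} and its commutator with lift₁ last reaches
-- the odd function lift₀ δxᵏ at depth 2^N − 1, one step earlier than Ω_(N+1) would.
module _ (N : ℕ) where
  private
    N+1 : ℕ
    N+1 = suc N
    σ-odd : Omega
    σ-odd w = σ-level N+1 (δxᵏ ⊕ δyᵏ) w xor root w

    σ-odd-L : ∀ (u : Vec Bool N+1) → σ-odd (toList u) ≡ (δxᵏ ⊕ δyᵏ) u
    σ-odd-L (y ∷ w) = trans (xor-identityʳ _) (σ-level-L N+1 (δxᵏ ⊕ δyᵏ) (y ∷ w))

    σ-odd-∈M : M-below N+1 (suc N+1) σ-odd
    σ-odd-∈M =
      trans (phi≡parity N+1 σ-odd)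
            (trans (parity-resp N+1 σ-odd-L)
                   (trans (parity-⊕ N+1 δxᵏ δyᵏ) (cong₂ _xor_ (parity-δxᵏ N+1) (parity-δyᵏ N+1)))) ,
      λ { [] ()
        ; (y ∷ w) N+1<∣w∣ → trans (xor-identityʳ _) (σ-level-supported N+1 _ (y ∷ w) N+1<∣w∣) }

    δ-split : ∀ (u : Vec Bool (suc N)) → (δxᵏ u xor δyᵏ u) ∧ not (last u) ≡ δxᵏ u
    δ-split u = begin
      (δxᵏ u xor δyᵏ u) ∧ not (last u)               ≡⟨ ∧-distribʳ-xor (not (last u)) (δxᵏ u) (δyᵏ u) ⟩
      δxᵏ u ∧ not (last u) xor δyᵏ u ∧ not (last u)  ≡⟨ cong₂ _xor_ (δxᵏ-last u) (δyᵏ-last u) ⟩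
      δxᵏ u xor false                                ≡⟨ xor-identityʳ (δxᵏ u) ⟩
      δxᵏ u                                          ∎
      where open ≡-Reasoning

    σ-odd-commutator : ((σ-odd · lift₁ last) ⊕ lift₁ last) ⊕ lift₁ 1ᴹ ≗ lift₀ {N+1} δxᵏ
    σ-odd-commutator (x ∷ u)
      rewrite actInv-∷ σ-odd x u | last-actInv σ-odd u | σ-odd-L u
            | σ-level-off N+1 (δxᵏ ⊕ δyᵏ) [] (λ ()) =
      trans (shape x (first u) ((δxᵏ ⊕ δyᵏ) u) (first (actInv σ-odd u)) (last u)) (δ-split u)
      where
      shape : ∀ x a e b r →
        (((x xor a xor e xor b) xor b) ∧ (r xor false xor true) xor (x xor a) ∧ r)
          xor (x xor a) ∧ true ≡ e ∧ not r
      shape = tautology 5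

  lift₀-δxᵏ-depth : IPow (M-below N+1 (suc N+1)) (2 ^ N+1 ∸ 1) (lift₀ {N+1} δxᵏ)
  lift₀-δxᵏ-depth = IPow-idx suc[2^∸2]
    (ext σ-odd-commutator (IPow-⊕ _ commutator (IPow-idx (sym suc[2^∸2]) (lift₁-1ᴹ-depth N+1))))
    where
    suc[2^∸2] : suc (2 ^ N+1 ∸ 2) ≡ 2 ^ N+1 ∸ 1
    suc[2^∸2] = sym (+-∸-assoc 1 (*-monoʳ-≤ 2 (1≤2^ N)))
    commutator : IPow (M-below N+1 (suc N+1)) (suc (2 ^ N+1 ∸ 2)) ((σ-odd · lift₁ last) ⊕ lift₁ last)
    commutator = gen σ-odd (lift₁ last) σ-odd-∈M (IPow-lift₁-M N+1 (Fil⇒IPow N+1 (Fil-last N)))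

lift₀-depth-base : ∀ N (g : Module N) → IPow (M-below N (suc N)) (2 ^ N ∸ 1) (lift₀ g)
lift₀-depth-base zero    g = everything _
lift₀-depth-base (suc N) g with parity (suc N) g in Σg
... | false = IPow-pred _ (IPow-idx (sym (suc[2^∸1]≡2^ (suc N))) (lift₀-even-depth (suc N) {g} Σg))
... | true  = ext (λ { (x ∷ u) → trans (xor-assoc (g u) (δxᵏ u) (δxᵏ u))
                                        (xor-cancelʳ (g u) (δxᵏ u)) })
                  (IPow-⊕ _ (IPow-pred _ (IPow-idx (sym (suc[2^∸1]≡2^ (suc N)))
                                                   (lift₀-even-depth (suc N) {g ⊕ δxᵏ} Σ[g⊕δ]≡0)))
                            (lift₀-δxᵏ-depth N))
  where
  Σ[g⊕δ]≡0 : parity (suc N) (g ⊕ δxᵏ) ≡ false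
  Σ[g⊕δ]≡0 = trans (parity-⊕ (suc N) g δxᵏ) (cong₂ _xor_ Σg (parity-δxᵏ (suc N)))

parity-∧ʳ : ∀ k (h : Module k) b → parity k (λ u → h u ∧ b) ≡ parity k h ∧ b
parity-∧ʳ zero    h b = refl
parity-∧ʳ (suc k) h b =
  trans (parity-resp k (λ u → sym (∧-distribʳ-xor b (h (false ∷ u)) (h (true ∷ u)))))
        (parity-∧ʳ k _ b)

-- For σ ∈ ker φ_N the commutator skips layer 2^N of F_2^{L_(N+1)}: on the last layer of
-- F_2^{L_N} the correction term of split₀-commutator is σ(u) ∧ c with c constant, whose
-- parity is φ_N(σ) ∧ c = 0.
M-commutator-jump : ∀ N σ → M-e N σ → ∀ {g : Module (suc N)} →
  Fil (suc N) (2 ^ N ∸ 1) g → Fil (suc N) (suc (2 ^ N)) ((σ · g) ⊕ g)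
M-commutator-jump N σ σ∈M {g} (fil-layers F₁ F₀) = fil-layers C₁ C₀
  where
  c : Bool
  c = split₁ g (replicate N false)
  split₁-constant : ∀ u → split₁ g u ≡ c
  split₁-constant u = Fil-last-constant N F₁ u (replicate N false)
  correction : Fil N 1 (λ u → σ (toList u) ∧ (σ · split₁ g) u)
  correction =
    Fil-resp N (λ u → cong (σ (toList u) ∧_) (sym (split₁-constant (actInv σ u))))
      (Fil-parity N (trans (parity-∧ʳ N (λ u → σ (toList u)) c)
                           (cong (_∧ c) (trans (sym (phi≡parity N σ)) σ∈M))))
  C₁ : Fil N (suc (2 ^ N)) (split₁ ((σ · g) ⊕ g))
  C₁ = Fil-resp N (λ u → sym (split₁-commutator σ g u))
         (Fil-beyond N (≤-reflexive (sym (suc[2^∸1]≡2^ N))) (Fil-commutator N σ F₁))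
  C₀ : Fil N (suc (2 ^ N) ∸ 2 ^ N) (split₀ ((σ · g) ⊕ g))
  C₀ = Fil-idx N (sym (m+n∸n≡m 1 (2 ^ N)))
         (Fil-resp N (λ u → sym (split₀-commutator σ g u))
           (Fil-⊕ N (Fil-commutator N σ (Fil-top N (split₀ g))) correction))

ρ-2^ : ∀ N → ρ N (2 ^ N) ≡ suc (2 ^ N)
ρ-2^ N = ≤-antisym (ρ-≤ N (2^<2^suc N)) (ρ-≥ N ≤-refl)

CommutatorBound : ℕ → ℕ → Set
CommutatorBound N k =
  ∀ σ → M-e N σ → ∀ i {g : Module k} → Fil k (ρ N i) g → Fil k (ρ N (suc i)) ((σ · g) ⊕ g)

Generation : ℕ → ℕ → Set
Generation N k = ∀ i {g : Module k} → Fil k (ρ N i) g → IPow (M-below N k) i g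

commutatorBound-base : ∀ N → CommutatorBound N (suc N)
commutatorBound-base N σ σ∈M i {g} F with <-cmp (suc i) (2 ^ N)
... | tri< si<2^N _ _ =
  Fil-idx (suc N) (trans (cong suc (ρ-id N (<-trans (n<1+n i) si<2^N))) (sym (ρ-id N si<2^N)))
    (Fil-commutator (suc N) σ F)
... | tri≈ _ si≡2^N _ =
  Fil-idx (suc N) (sym (trans (cong (ρ N) si≡2^N) (ρ-2^ N)))
    (M-commutator-jump N σ σ∈M (Fil-idx (suc N) ρi≡2^N∸1 F))
  where
  ρi≡2^N∸1 : ρ N i ≡ 2 ^ N ∸ 1
  ρi≡2^N∸1 = trans (ρ-id N (subst (i <_) si≡2^N (n<1+n i))) (cong (_∸ 1) si≡2^N)
... | tri> _ _ 2^N<si with suc i <? 2 ^ suc N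
...   | yes si<2^sucN =
  Fil-antitone (suc N) (≤-trans (ρ-≤ N si<2^sucN) (s≤s (ρ-≥ N (≤-pred 2^N<si))))
    (Fil-commutator (suc N) σ F)
...   | no  si≮2^sucN =
  Fil-beyond (suc N)
    (≤-trans (≮⇒≥ si≮2^sucN) (s≤s (≤-trans (n≤1+n i) (ρ-≥ N (≤-pred 2^N<si)))))
    (Fil-commutator (suc N) σ F)

∸[2^∸1]≤ρ∸2^ : ∀ N j → j ∸ (2 ^ N ∸ 1) ≤ ρ N j ∸ 2 ^ N
∸[2^∸1]≤ρ∸2^ N j with 2 ^ N ≤? j
... | yes 2^N≤j = subst (_≤ ρ N j ∸ 2 ^ N) (sym (m∸[n∸1]≡1+m∸n j (1≤2^ N)))
                        (∸-monoˡ-≤ (2 ^ N) (ρ-≥ N 2^N≤j))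
... | no  2^N≰j =
  subst (_≤ ρ N j ∸ 2 ^ N) (sym (m≤n⇒m∸n≡0 (m<n⇒m≤n∸1 (≰⇒> 2^N≰j)))) z≤n

generation-base : ∀ N → Generation N (suc N)
generation-base N i (fil-layers F₁ F₀) =
  IPow-split (IPow-lift₀ (M-below-⊇Ω N) (2 ^ N ∸ 1) (lift₀-depth-base N) i
                         (λ _ → Fil⇒IPow N (Fil-antitone N (∸[2^∸1]≤ρ∸2^ N i) F₀)))
             (IPow-lift₁-M N (Fil⇒IPow N (Fil-antitone N (m≤m+n i _) F₁)))

-- From L_k to L_(k+1): in M, lift₀ costs c steps while it moves 2^k layers down, and the
-- periodicity of ρ matches the two.
module Periodic (N k c : ℕ) (N<k : N < k) (1≤c : 1 ≤ c)
                (ρ-period : ∀ i → ρ N (i + c) ≡ ρ N i + 2 ^ k) where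

  ρ-c : ρ N c ≡ 2 ^ k
  ρ-c = trans (ρ-period 0) (cong (_+ 2 ^ k) (ρ-0 N))

  ρ-after-c : ∀ {i} → c ≤ i → ρ N i ≡ ρ N (i ∸ c) + 2 ^ k
  ρ-after-c {i} c≤i = trans (cong (ρ N) (sym (m∸n+n≡m c≤i))) (ρ-period (i ∸ c))

  ρ∸2^ : ∀ {i} → c ≤ i → ρ N i ∸ 2 ^ k ≡ ρ N (i ∸ c)
  ρ∸2^ {i} c≤i = trans (cong (_∸ 2 ^ k) (ρ-after-c c≤i)) (m+n∸n≡m (ρ N (i ∸ c)) (2 ^ k))

  commutatorBound-suc : CommutatorBound N k → CommutatorBound N (suc k)
  commutatorBound-suc bound σ σ∈M i {g} (fil-layers F₁ F₀) =
    fil-layers (Fil-resp k (λ u → sym (split₁-commutator σ g u)) (bound σ σ∈M i F₁)) C₀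
    where
    C₀ : Fil k (ρ N (suc i) ∸ 2 ^ k) (split₀ ((σ · g) ⊕ g))
    C₀ with c ≤? i
    ... | yes c≤i =
      Fil-idx k (sym (trans (ρ∸2^ (≤-trans c≤i (n≤1+n i))) (cong (ρ N) (+-∸-assoc 1 c≤i))))
        (Fil-resp k (λ u → sym (split₀-commutator′ σ g split₁≗0 u))
          (bound σ σ∈M (i ∸ c) (Fil-idx k (ρ∸2^ c≤i) F₀)))
      where
      split₁≗0 : split₁ g ≗ 0ᴹ
      split₁≗0 = Fil-vanishes k (subst (2 ^ k ≤_) (sym (ρ-after-c c≤i)) (m≤n+m (2 ^ k) _)) F₁
    ... | no c≰i =
      Fil-idx k (sym (m≤n⇒m∸n≡0 (subst (ρ N (suc i) ≤_) ρ-c (ρ-mono N (≰⇒> c≰i)))))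
        (Fil-top k _)

  private
    M-below-suc : ∀ σ → M-below N k σ → M-below N (suc k) σ
    M-below-suc σ (σ∈M , σ<k) = σ∈M , SupportedBelow-suc σ σ<k

    M-below-L : ∀ σ → M-below N k σ → ∀ u → σ (toList u) ≡ false
    M-below-L σ (_ , σ<k) = SupportedBelow-L σ σ<k

  generation-suc : Generation N k → Generation N (suc k)
  generation-suc generate i (fil-layers F₁ F₀) =
    IPow-split (IPow-lift₀ M-below-suc c lift₀-depth i
                           (λ c≤i → generate (i ∸ c) (Fil-idx k (ρ∸2^ c≤i) F₀)))
               (IPow-lift₁ M-below-suc M-below-L (generate i F₁))
    where
    suc[c∸1]≡c : suc (c ∸ 1) ≡ c
    suc[c∸1]≡c = trans (sym (+-∸-assoc 1 1≤c)) (m+n∸m≡n 1 c)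
    ρ[c∸1]≤2^∸1 : ρ N (c ∸ 1) ≤ 2 ^ k ∸ 1
    ρ[c∸1]≤2^∸1 =
      m<n⇒m≤n∸1 (subst (ρ N (c ∸ 1) <_) (trans (cong (ρ N) suc[c∸1]≡c) ρ-c) (ρ-< N (c ∸ 1)))
    σ-level-∈M : ∀ h → M-e N (σ-level k h)
    σ-level-∈M h = trans (phi≡parity N _)
      (parity-0ᴹ N (λ u → σ-level-off k h (toList u)
                            (λ ∣u∣≡k → <-irrefl (trans (sym (length-toList u)) ∣u∣≡k) N<k)))
    lift₀-depth : ∀ h → IPow (M-below N (suc k)) c (lift₀ h)
    lift₀-depth h = IPow-idx suc[c∸1]≡c
      (ext (σ-level-commutator h)
           (gen (σ-level k h) (lift₁ 1ᴹ) (σ-level-∈M h , σ-level-supported k h)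
                (IPow-lift₁ M-below-suc M-below-L
                   (generate (c ∸ 1) (Fil-antitone k ρ[c∸1]≤2^∸1 (Fil-1ᴹ k))))))

M-layers : ∀ N t → CommutatorBound N (t + suc N) × Generation N (t + suc N)
M-layers N zero    = commutatorBound-base N , generation-base N
M-layers N (suc t) =
  commutatorBound-suc (proj₁ (M-layers N t)) , generation-suc (proj₂ (M-layers N t))
  where
  D : ℕ
  D = 2 ^ suc N ∸ 1
  open Periodic N (t + suc N) (2 ^ t * D) (m≤n+m (suc N) t)
    (*-mono-≤ (1≤2^ t) (1≤2^suc∸1 N))
    (λ i → trans (ρ-periodic N (2 ^ t) i) (cong (ρ N i +_) (sym (^-distribˡ-+-* 2 t (suc N)))))

IPow-M⇔Fil-ρ-shallow : ∀ N k → k ≤ N → ∀ i (v : Module k) → IPow (M-e N) i v ⇔ Fil k (ρ N i) v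
IPow-M⇔Fil-ρ-shallow N k k≤N i v =
  ⇔.trans (IPow⇔Fil k (λ σ → phi-SupportedBelow σ k≤N) i v) (mk⇔ to (Fil-antitone k (m≤m+n i _)))
  where
  to : Fil k i v → Fil k (ρ N i) v
  to F with i <? 2 ^ N
  ... | yes i<2^N = Fil-idx k (sym (ρ-id N i<2^N)) F
  ... | no  i≮2^N = Fil-beyond k (≤-trans (^-monoʳ-≤ 2 k≤N) (≮⇒≥ i≮2^N)) F

IPow-M⇔Fil-ρ-deep : ∀ N t i (v : Module (t + suc N)) → IPow (M-e N) i v ⇔ Fil (t + suc N) (ρ N i) v
IPow-M⇔Fil-ρ-deep N t i v =
  mk⇔ (IPow⇒Fil (ρ N) (ρ-0 N) (λ σ σ∈M → bound σ σ∈M _))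
      (λ F → IPow-⊆ (λ σ → proj₁) (generate i F))
  where
  bound : CommutatorBound N (t + suc N)
  bound = proj₁ (M-layers N t)
  generate : Generation N (t + suc N)
  generate = proj₂ (M-layers N t)

IPow-M⇔Fil-ρ : ∀ N k i (v : Module k) → IPow (M-e N) i v ⇔ Fil k (ρ N i) v
IPow-M⇔Fil-ρ N k i v with k ≤? N
... | yes k≤N = IPow-M⇔Fil-ρ-shallow N k k≤N i v
... | no  k≰N rewrite sym (m∸n+n≡m (≰⇒> k≰N)) = IPow-M⇔Fil-ρ-deep N (k ∸ suc N) i v

proposition6p13 : (N k i : ℕ) (v : Vec Bool k → Bool) →
    IPow (M-e N) i v ⇔ IPow Whole (i + roundDiv i (2 ^ suc N ∸ 1)) v
proposition6p13 N k i v =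
  ⇔.trans (IPow-M⇔Fil-ρ N k i v) (⇔.sym (IPow⇔Fil k (λ _ _ → tt) (ρ N i) v))
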